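{- Let $t$ be a positive integer and let $G$ be a graph with no odd $K_t$ minor. Then $$\chi(G) \leq 2t\left(1 + \log\left(\frac{|V(G)|}{t}\right)\right).$$
   Context: All graphs are finite and simple; $\log$ is the natural logarithm. A graph $G$ has an odd $K_t$ minor if a graph isomorphic to $K_t$ can be obtained from a subgraph $G'$ of $G$ by contracting a set of edges forming a cut of $G'$ (the empty set is a cut). -}

module Defs where

open import Data.Nat using (ℕ; zero; suc; _+_; _*_; _∸_; _^_; _≤_; _<_; _!)
open import Data.Fin using (Fin)
open import Data.Bool using (Bool; true; false)
open import Data.Product using (Σ; ∃; _×_; _,_)
open import Data.Sum using (_⊎_)
open import Relation.Nullary using (¬_)
open import Relation.Binary.PropositionalEquality using (_≡_; _≢_)
open import Relation.Binary.Construct.Closure.ReflexiveTransitive using (Star)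

record Graph (n : ℕ) : Set where
  field
    adj    : Fin n → Fin n → Bool
    sym    : ∀ u v → adj u v ≡ adj v u
    irrefl : ∀ v → adj v v ≡ false

Edge : ∀ {n} → Graph n → Fin n → Fin n → Set
Edge G u v = Graph.adj G u v ≡ true

record Subgraph {n : ℕ} (G : Graph n) : Set₁ where
  field
    inV    : Fin n → Set
    inE    : Fin n → Fin n → Set
    inE-sym  : ∀ {u v} → inE u v → inE v u
    inE-edge : ∀ {u v} → inE u v → Edge G u v
    inE-ends : ∀ {u v} → inE u v → inV u × inV v

CutEdge : ∀ {n} {G : Graph n} → Subgraph G → (Fin n → Set) → Fin n → Fin n → Set
CutEdge H X u v = Subgraph.inE H u v × ((X u × ¬ X v) ⊎ (¬ X u × X v))

-- Contracting the edge set F of G' yields (after deleting loops and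
-- parallel edges) a graph isomorphic to K_t: the vertices of the
-- contraction are the classes of V(G') under connectivity in (V(G'), F);
-- we ask for a bijection f between these classes and Fin t such that any
-- two distinct classes are joined by an edge of G'.
ContractsToK : ∀ {n} {G : Graph n} (H : Subgraph G)
               (F : Fin n → Fin n → Set) (t : ℕ) → Set
ContractsToK {n} H F t =
  Σ ((v : Fin n) → Subgraph.inV H v → Fin t) λ f →
    (∀ i → ∃ λ v → Σ (Subgraph.inV H v) λ p → f v p ≡ i)
  × (∀ u v (p : Subgraph.inV H u) (q : Subgraph.inV H v) →
       (f u p ≡ f v q → Star F u v) × (Star F u v → f u p ≡ f v q))
  × (∀ i j → i ≢ j → ∃ λ u → ∃ λ v → Σ (Subgraph.inE H u v) λ e →
       f u (Data.Product.proj₁ (Subgraph.inE-ends H e)) ≡ i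
     × f v (Data.Product.proj₂ (Subgraph.inE-ends H e)) ≡ j)

HasOddMinor : ∀ {n} → Graph n → ℕ → Set₁
HasOddMinor {n} G t =
  Σ (Subgraph G) λ H → Σ (Fin n → Set) λ X →
    ((v : Fin n) → X v → Subgraph.inV H v) × ContractsToK H (CutEdge H X) t

ProperColouring : ∀ {n} → Graph n → (k : ℕ) → (Fin n → Fin k) → Set
ProperColouring G k c = ∀ u v → Edge G u v → c u ≢ c v

-- Exponential and logarithm, expressed in ℕ arithmetic via the series
-- e^m = Σ_j m^j / j!.
--
-- expPartial m N = N! * Σ_{j ≤ N} m^j / j!   (a natural number)

expPartial : ℕ → ℕ → ℕ
expPartial m zero    = 1
expPartial m (suc N) = suc N * expPartial m N + m ^ suc N

-- "e^m · A ≤ B"  (e^m is the supremum of the partial sums)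
ExpTimesLe : ℕ → ℕ → ℕ → Set
ExpTimesLe m A B = ∀ N → expPartial m N * A ≤ (N !) * B

-- "A ≤ e^p · B"  : for every q, some partial sum S_N satisfies
-- A - S_N · B ≤ 1/(q+1)
LeExpTimes : ℕ → ℕ → ℕ → Set
LeExpTimes p A B =
  ∀ q → ∃ λ N → suc q * A * (N !) ≤ suc q * expPartial p N * B + N !

-- LogBound t n k  means the real inequality  k ≤ 2t(1 + log(n/t))
-- (for t ≥ 1, n ≥ 1), which is equivalent to  e^(k - 2t) · t^(2t) ≤ n^(2t).
LogBound : ℕ → ℕ → ℕ → Set
LogBound t n k =
    (2 * t ≤ k × ExpTimesLe (k ∸ 2 * t) (t ^ (2 * t)) (n ^ (2 * t)))
  ⊎ (k < 2 * t × LeExpTimes (2 * t ∸ k) (t ^ (2 * t)) (n ^ (2 * t)))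

-- An odd-K_t-minor-free graph on m vertices has an independent set of at least m/(2t − 1)
-- vertices. Grow from one vertex a connected bipartite set I ∪ C with I independent and
-- |C| < |I|, until no vertex outside it and non-adjacent to I (the remote set R) has a
-- neighbour in C or among the vertices adjacent to I (the attached set A). Then A has no odd
-- K_(t−1) minor, for I ∪ C could be added to one as a further branch set, cut along I or
-- along C. By induction on t and on the number of vertices, A and R contain independent sets
-- J_A and J_R of the right size; with J₀ the larger of I and J_A, the set J_R ∪ J₀ is
-- independent and |I| + |C| + |A| + |R| ≤ 2|J₀| + (2t − 3)|J₀| + (2t − 1)|J_R|.
-- Colouring greedily by such independent sets, every colour after the first 2t shrinks the
-- uncoloured part by a factor (2t − 1)/2t; as (2t/(2t − 1))^(2t) ≥ e, the number r of these
-- extra colours satisfies r ≤ 2t log(n/t).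
module Submission where

open import Defs
open import Data.Nat using (ℕ; _≤_; suc)
open import Data.Fin using (Fin)
open import Data.Product using (Σ; ∃; _×_)
open import Relation.Nullary using (¬_)

open import Data.Bool.Base using (true)
import Data.Bool.Properties as Bool
open import Data.Empty using (⊥; ⊥-elim)
open import Data.Fin.Base using (zero; suc; fromℕ; inject₁)
import Data.Fin.Properties as Fin
open import Data.Fin.Properties using (any?; fromℕ≢inject₁; inject₁-injective)
open import Data.Fin.Subset
  using (Subset; _∈_; _∉_; _⊆_; _∪_; _∩_; _─_; ⁅_⁆; ∣_∣; ⊤; Empty; inside; outside)
  renaming (⊥ to ∅)
open import Data.Fin.Subset.Properties
  using ( _∈?_; nonempty?; ∈⊤; ∣⊤∣≡n; ∉⊥; ∣⊥∣≡0; ∣⁅x⁆∣≡1; x∈⁅x⁆; x∈⁅y⁆⇒x≡y; Empty-unique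
        ; ⊆-antisym; p⊂q⇒∣p∣<∣q∣; p⊆p∪q; q⊆p∪q; x∈p∪q⁻; x∈p∪q⁺; p∩q⊆q; x∈p∩q⁻; x∈p∩q⁺
        ; p─q⊆p; x∈p∧x∉q⇒x∈p─q)
open import Data.Nat.Base using (zero; _+_; _*_; _^_; _<_; _!; pred; NonZero; z≤n; s≤s)
open import Data.Nat.Induction using (<-wellFounded)
open import Data.Nat.Properties
open import Data.Nat.Tactic.RingSolver using (solve-∀)
open import Data.Product using (_,_; proj₁; proj₂)
open import Data.Sum using (_⊎_; inj₁; inj₂; [_,_]′)
open import Data.Vec.Base using ([]; _∷_; here; there; tabulate)
open import Data.Vec.Properties using (lookup⇒[]=; []=⇒lookup; lookup∘tabulate)
open import Effect.Monad using (RawMonad)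
open import Function using (_∘_; id; case_of_; Equivalence)
open import Induction.WellFounded using (Acc; acc)
open import Level using (0ℓ)
open import Relation.Binary.Construct.Closure.ReflexiveTransitive using (Star; ε; _◅_; _◅◅_)
import Relation.Binary.Construct.Closure.ReflexiveTransitive as Star
open import Relation.Binary.PropositionalEquality
  using (_≡_; _≢_; refl; sym; trans; cong; cong₂; subst; subst₂; module ≡-Reasoning)
open import Relation.Nullary using (Dec; yes; no)
open import Relation.Nullary.Decidable
  using (_×-dec_; ⌊_⌋; toWitness; fromWitness; decidable-stable; ¬¬-excluded-middle)
open import Relation.Nullary.Negation using (¬¬-Monad)

private
  variable
    n : ℕ
    x : Fin n

-- The exponential series and the negative binomial series

^-distribʳ-* : ∀ m n o → (m * n) ^ o ≡ m ^ o * n ^ o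
^-distribʳ-* m n zero    = refl
^-distribʳ-* m n (suc o) = begin
  m * n * (m * n) ^ o       ≡⟨ cong (m * n *_) (^-distribʳ-* m n o) ⟩
  m * n * (m ^ o * n ^ o)   ≡⟨ regroup m n (m ^ o) (n ^ o) ⟩
  m * m ^ o * (n * n ^ o)   ∎
  where
  open ≡-Reasoning
  regroup : ∀ a b c d → a * b * (c * d) ≡ a * c * (b * d)
  regroup = solve-∀

risingFactorial : ℕ → ℕ → ℕ
risingFactorial M zero    = 1
risingFactorial M (suc j) = risingFactorial M j * (M + j)

risingFactorial-suc : ∀ M j → risingFactorial M (suc j) ≡ M * risingFactorial (suc M) j
risingFactorial-suc M zero    = trans (*-identityˡ (M + 0)) (trans (+-identityʳ M) (sym (*-identityʳ M)))
risingFactorial-suc M (suc j) = begin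
  risingFactorial M (suc j) * (M + suc j)       ≡⟨ cong₂ _*_ (risingFactorial-suc M j) (+-suc M j) ⟩
  M * risingFactorial (suc M) j * (suc M + j)   ≡⟨ *-assoc M _ _ ⟩
  M * risingFactorial (suc M) (suc j)           ∎
  where open ≡-Reasoning

risingFactorial-pascal : ∀ M j →
  risingFactorial (suc M) (suc j) ≡ risingFactorial M (suc j) + suc j * risingFactorial (suc M) j
risingFactorial-pascal M j = begin
  risingFactorial (suc M) j * (suc M + j)
    ≡⟨ split M j (risingFactorial (suc M) j) ⟩
  M * risingFactorial (suc M) j + suc j * risingFactorial (suc M) j
    ≡⟨ cong (_+ suc j * risingFactorial (suc M) j) (risingFactorial-suc M j) ⟨
  risingFactorial M (suc j) + suc j * risingFactorial (suc M) j
    ∎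
  where
  open ≡-Reasoning
  split : ∀ M j x → x * (suc M + j) ≡ M * x + suc j * x
  split = solve-∀

^≤risingFactorial : ∀ M j → M ^ j ≤ risingFactorial M j
^≤risingFactorial M zero    = ≤-refl
^≤risingFactorial M (suc j) = begin
  M * M ^ j                        ≤⟨ *-mono-≤ (m≤m+n M j) (^≤risingFactorial M j) ⟩
  (M + j) * risingFactorial M j    ≡⟨ *-comm (M + j) _ ⟩
  risingFactorial M j * (M + j)    ∎
  where open ≤-Reasoning

-- negBinomial s M N = N! sᴺ Σ_{j ≤ N} M⁽ʲ⁾ / (j! sʲ) with M⁽ʲ⁾ the rising factorial: a partial
-- sum of the series of (1 − 1/s)^(−M), scaled into ℕ.
negBinomial : ℕ → ℕ → ℕ → ℕ
negBinomial s M zero    = 1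
negBinomial s M (suc N) = suc N * s * negBinomial s M N + risingFactorial M (suc N)

negBinomial-zero : ∀ s N → negBinomial s 0 N ≡ N ! * s ^ N
negBinomial-zero s zero    = refl
negBinomial-zero s (suc N) = begin
  suc N * s * negBinomial s 0 N + risingFactorial 0 (suc N)
    ≡⟨ cong₂ (λ a b → suc N * s * a + b) (negBinomial-zero s N) (risingFactorial-suc 0 N) ⟩
  suc N * s * (N ! * s ^ N) + 0
    ≡⟨ regroup (suc N) s (N !) (s ^ N) ⟩
  suc N * N ! * (s * s ^ N)
    ∎
  where
  open ≡-Reasoning
  regroup : ∀ a s f x → a * s * (f * x) + 0 ≡ a * f * (s * x)
  regroup = solve-∀

negBinomial-pascal : ∀ s M N →
  negBinomial s (suc M) (suc N) ≡ negBinomial s M (suc N) + suc N * negBinomial s (suc M) N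
negBinomial-pascal s M zero = base s M
  where
  base : ∀ s M → 1 * s * 1 + 1 * (suc M + 0) ≡ (1 * s * 1 + 1 * (M + 0)) + 1 * 1
  base = solve-∀
negBinomial-pascal s M (suc N) = begin
  n₂ * s * negBinomial s (suc M) (suc N) + risingFactorial (suc M) n₂
    ≡⟨ cong₂ (λ a b → n₂ * s * a + b) (negBinomial-pascal s M N) (risingFactorial-pascal M (suc N)) ⟩
  n₂ * s * (negBinomial s M (suc N) + suc N * negBinomial s (suc M) N)
    + (risingFactorial M n₂ + n₂ * risingFactorial (suc M) (suc N))
    ≡⟨ regroup N s (negBinomial s M (suc N)) (negBinomial s (suc M) N)
               (risingFactorial M n₂) (risingFactorial (suc M) (suc N)) ⟩
  (n₂ * s * negBinomial s M (suc N) + risingFactorial M n₂)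
    + n₂ * (suc N * s * negBinomial s (suc M) N + risingFactorial (suc M) (suc N))
    ∎
  where
  open ≡-Reasoning
  n₂ = suc (suc N)
  regroup : ∀ N s a b c d → suc (suc N) * s * (a + suc N * b) + (c + suc (suc N) * d)
                          ≡ (suc (suc N) * s * a + c) + suc (suc N) * (suc N * s * b + d)
  regroup = solve-∀

negBinomial-bound : ∀ p M N → p ^ M * negBinomial (suc p) M N ≤ N ! * suc p ^ N * suc p ^ M
negBinomial-bound p zero N = ≤-reflexive (begin
  1 * negBinomial (suc p) 0 N  ≡⟨ *-identityˡ _ ⟩
  negBinomial (suc p) 0 N      ≡⟨ negBinomial-zero (suc p) N ⟩
  N ! * suc p ^ N              ≡⟨ *-identityʳ _ ⟨
  N ! * suc p ^ N * 1          ∎)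
  where open ≡-Reasoning
negBinomial-bound p (suc M) zero = begin
  p * p ^ M * 1              ≡⟨ *-identityʳ _ ⟩
  p ^ suc M                  ≤⟨ ^-monoˡ-≤ (suc M) (n≤1+n p) ⟩
  suc p ^ suc M              ≡⟨ *-identityˡ _ ⟨
  1 * 1 * suc p ^ suc M      ∎
  where open ≤-Reasoning
negBinomial-bound p (suc M) (suc N) = begin
  p * p ^ M * negBinomial s (suc M) (suc N)
    ≡⟨ cong (p * p ^ M *_) (negBinomial-pascal s M N) ⟩
  p * p ^ M * (negBinomial s M (suc N) + suc N * negBinomial s (suc M) N)
    ≡⟨ distribute p (p ^ M) (negBinomial s M (suc N)) N (negBinomial s (suc M) N) ⟩
  p * (p ^ M * negBinomial s M (suc N)) + suc N * (p ^ suc M * negBinomial s (suc M) N)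
    ≤⟨ +-mono-≤ (*-monoʳ-≤ p (negBinomial-bound p M (suc N)))
                (*-monoʳ-≤ (suc N) (negBinomial-bound p (suc M) N)) ⟩
  p * (suc N ! * s ^ suc N * s ^ M) + suc N * (N ! * s ^ N * s ^ suc M)
    ≡⟨ collect p N (N !) (s ^ N) (s ^ M) ⟩
  suc N ! * s ^ suc N * s ^ suc M
    ∎
  where
  open ≤-Reasoning
  s = suc p
  distribute : ∀ p a c N d → p * a * (c + suc N * d) ≡ p * (a * c) + suc N * (p * a * d)
  distribute = solve-∀
  collect : ∀ p N f a b → p * ((suc N * f) * (suc p * a) * b) + suc N * (f * a * (suc p * b))
                        ≡ (suc N * f) * (suc p * a) * (suc p * b)
  collect = solve-∀

expPartial≤negBinomial : ∀ s r N → expPartial r N * s ^ N ≤ negBinomial s (r * s) N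
expPartial≤negBinomial s r zero = ≤-refl
expPartial≤negBinomial s r (suc N) = begin
  (suc N * expPartial r N + r ^ suc N) * (s * s ^ N)
    ≡⟨ distribute (suc N) (expPartial r N) (r ^ suc N) s (s ^ N) ⟩
  suc N * s * (expPartial r N * s ^ N) + r ^ suc N * s ^ suc N
    ≡⟨ cong (suc N * s * (expPartial r N * s ^ N) +_) (^-distribʳ-* r s (suc N)) ⟨
  suc N * s * (expPartial r N * s ^ N) + (r * s) ^ suc N
    ≤⟨ +-mono-≤ (*-monoʳ-≤ (suc N * s) (expPartial≤negBinomial s r N)) (^≤risingFactorial (r * s) (suc N)) ⟩
  suc N * s * negBinomial s (r * s) N + risingFactorial (r * s) (suc N)
    ∎
  where
  open ≤-Reasoning
  distribute : ∀ a e q s b → (a * e + q) * (s * b) ≡ a * s * (e * b) + q * (s * b)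
  distribute = solve-∀

-- eʳ = Σ rʲ/j! ≤ Σ (rs)⁽ʲ⁾/(j! sʲ) = (1 − 1/s)^(−rs) with s = p + 1, i.e. eʳ pʳˢ ≤ sʳˢ.
exp≤ratio^ : ∀ p r → ExpTimesLe r (p ^ (r * suc p)) (suc p ^ (r * suc p))
exp≤ratio^ p r N = *-cancelʳ-≤ _ _ (s ^ N) {{m^n≢0 s N}} (begin
  expPartial r N * p ^ M * s ^ N         ≡⟨ swap (expPartial r N) (p ^ M) (s ^ N) ⟩
  p ^ M * (expPartial r N * s ^ N)       ≤⟨ *-monoʳ-≤ (p ^ M) (expPartial≤negBinomial s r N) ⟩
  p ^ M * negBinomial s M N              ≤⟨ negBinomial-bound p M N ⟩
  N ! * s ^ N * s ^ M                    ≡⟨ *-assoc (N !) _ _ ⟩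
  N ! * (s ^ N * s ^ M)                  ≡⟨ cong (N ! *_) (*-comm (s ^ N) (s ^ M)) ⟩
  N ! * (s ^ M * s ^ N)                  ≡⟨ *-assoc (N !) _ _ ⟨
  N ! * s ^ M * s ^ N                    ∎)
  where
  open ≤-Reasoning
  s = suc p
  M = r * s
  swap : ∀ a b c → a * b * c ≡ b * (a * c)
  swap = solve-∀

-- The logarithmic bound

ExpTimesLe-rescale : ∀ {m A B C D} .{{_ : NonZero B}} →
  ExpTimesLe m A B → C * B ≤ D * A → ExpTimesLe m C D
ExpTimesLe-rescale {m} {A} {B} {C} {D} eᵐA≤B CB≤DA N = *-cancelʳ-≤ _ _ B (begin
  expPartial m N * C * B     ≡⟨ *-assoc (expPartial m N) C B ⟩
  expPartial m N * (C * B)   ≤⟨ *-monoʳ-≤ (expPartial m N) CB≤DA ⟩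
  expPartial m N * (D * A)   ≡⟨ swap (expPartial m N) D A ⟩
  D * (expPartial m N * A)   ≤⟨ *-monoʳ-≤ D (eᵐA≤B N) ⟩
  D * (N ! * B)              ≡⟨ swap′ D (N !) B ⟩
  N ! * D * B                ∎)
  where
  open ≤-Reasoning
  swap : ∀ a b c → a * (b * c) ≡ b * (a * c)
  swap = solve-∀
  swap′ : ∀ a b c → a * (b * c) ≡ b * a * c
  swap′ = solve-∀

LeExpTimes-≤ : ∀ {p A B} → A ≤ B → LeExpTimes p A B
LeExpTimes-≤ {p} {A} {B} A≤B q = 0 , (begin
  suc q * A * 1          ≡⟨ *-identityʳ _ ⟩
  suc q * A              ≤⟨ *-monoʳ-≤ (suc q) A≤B ⟩
  suc q * B              ≡⟨ cong (_* B) (*-identityʳ (suc q)) ⟨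
  suc q * 1 * B          ≤⟨ m≤m+n _ 1 ⟩
  suc q * 1 * B + 1      ∎)
  where open ≤-Reasoning

data ColourBound (t m k : ℕ) : Set where
  few  : k < 2 * t → ColourBound t m k
  many : ∀ r → k ≡ 2 * t + r → t * (2 * t) ^ r ≤ m * pred (2 * t) ^ r → ColourBound t m k

logBound : ∀ {t n k} → 1 ≤ t → t ≤ n → ColourBound t n k → LogBound t n k
logBound {t} {n} _ t≤n (few k<2t) = inj₂ (k<2t , LeExpTimes-≤ (^-monoˡ-≤ (2 * t) t≤n))
logBound {suc t′} {n} _ t≤n (many r refl tsʳ≤npʳ) =
  inj₁ (m≤m+n s r , subst (λ r′ → ExpTimesLe r′ (t ^ s) (n ^ s)) (sym (m+n∸m≡n s r)) eʳtˢ≤nˢ)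
  where
  t = suc t′
  s = 2 * t
  p = pred s
  tˢsʳˢ≤nˢpʳˢ : t ^ s * s ^ (r * s) ≤ n ^ s * p ^ (r * s)
  tˢsʳˢ≤nˢpʳˢ = begin
    t ^ s * s ^ (r * s)   ≡⟨ cong (t ^ s *_) (^-*-assoc s r s) ⟨
    t ^ s * (s ^ r) ^ s   ≡⟨ ^-distribʳ-* t (s ^ r) s ⟨
    (t * s ^ r) ^ s       ≤⟨ ^-monoˡ-≤ s tsʳ≤npʳ ⟩
    (n * p ^ r) ^ s       ≡⟨ ^-distribʳ-* n (p ^ r) s ⟩
    n ^ s * (p ^ r) ^ s   ≡⟨ cong (n ^ s *_) (^-*-assoc p r s) ⟩
    n ^ s * p ^ (r * s)   ∎
    where open ≤-Reasoning
  eʳtˢ≤nˢ : ExpTimesLe r (t ^ s) (n ^ s)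
  eʳtˢ≤nˢ = ExpTimesLe-rescale {{m^n≢0 s (r * s)}} (exp≤ratio^ p r) tˢsʳˢ≤nˢpʳˢ

removal-ratio : ∀ p j m′ → j + m′ ≤ p * j → suc p * m′ ≤ p * (j + m′)
removal-ratio p j m′ m≤pj = +-cancelʳ-≤ (j + m′) (suc p * m′) (p * (j + m′)) (begin
  suc p * m′ + (j + m′)      ≤⟨ +-monoʳ-≤ (suc p * m′) (≤-trans m≤pj (*-monoˡ-≤ j (n≤1+n p))) ⟩
  suc p * m′ + suc p * j     ≡⟨ +-comm (suc p * m′) (suc p * j) ⟩
  suc p * j + suc p * m′     ≡⟨ *-distribˡ-+ (suc p) j m′ ⟨
  suc p * (j + m′)           ≡⟨ +-comm (j + m′) (p * (j + m′)) ⟩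
  p * (j + m′) + (j + m′)    ∎)
  where open ≤-Reasoning

ColourBound-step : ∀ {t m j m′ k} → 1 ≤ t → m ≡ j + m′ → suc k ≤ m →
  (m ≤ 2 * t ⊎ m ≤ pred (2 * t) * j) → ColourBound t m′ k → ColourBound t m (suc k)
ColourBound-step {suc t′} {m} {j} {m′} {k} _ _ k<m _ (few k<2t) with m≤n⇒m<n∨m≡n k<2t
... | inj₁ 1+k<2t = few 1+k<2t
... | inj₂ 1+k≡2t = many 0 (trans 1+k≡2t (sym (+-identityʳ _))) (begin
  t * 1    ≡⟨ *-identityʳ t ⟩
  t        ≤⟨ m≤m+n t _ ⟩
  2 * t    ≡⟨ 1+k≡2t ⟨
  suc k    ≤⟨ k<m ⟩
  m        ≡⟨ *-identityʳ m ⟨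
  m * 1    ∎)
  where
  open ≤-Reasoning
  t = suc t′
ColourBound-step {suc t′} _ _ k<m (inj₁ m≤2t) (many r refl _) =
  ⊥-elim (m+n≮m (2 * suc t′) r (≤-trans k<m m≤2t))
ColourBound-step {suc t′} {j = j} {m′} _ refl _ (inj₂ m≤pj) (many r refl tsʳ≤m′pʳ) =
  many (suc r) (sym (+-suc s r)) (begin
    t * (s * s ^ r)          ≡⟨ swap t s (s ^ r) ⟩
    s * (t * s ^ r)          ≤⟨ *-monoʳ-≤ s tsʳ≤m′pʳ ⟩
    s * (m′ * p ^ r)         ≡⟨ *-assoc s m′ (p ^ r) ⟨
    s * m′ * p ^ r           ≤⟨ *-monoˡ-≤ (p ^ r) (removal-ratio p j m′ m≤pj) ⟩
    p * (j + m′) * p ^ r     ≡⟨ swap′ p (j + m′) (p ^ r) ⟩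
    (j + m′) * (p * p ^ r)   ∎)
  where
  open ≤-Reasoning
  t = suc t′
  s = 2 * t
  p = pred s
  swap : ∀ a b c → a * (b * c) ≡ b * (a * c)
  swap = solve-∀
  swap′ : ∀ a b c → a * b * c ≡ b * (a * c)
  swap′ = solve-∀

-- Cardinalities of subsets

x∈p─q⇒x∉q : ∀ (p q : Subset n) → x ∈ p ─ q → x ∉ q
x∈p─q⇒x∉q (inside ∷ p) (outside ∷ q) here        ()
x∈p─q⇒x∉q (_      ∷ p) (_       ∷ q) (there x∈) (there x∈q) = x∈p─q⇒x∉q p q x∈ x∈q

∣p∪q∣≡∣p∣+∣q∣ : ∀ (p q : Subset n) → (∀ {x} → x ∈ p → x ∉ q) → ∣ p ∪ q ∣ ≡ ∣ p ∣ + ∣ q ∣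
∣p∪q∣≡∣p∣+∣q∣ []            []            _        = refl
∣p∪q∣≡∣p∣+∣q∣ (inside  ∷ p) (inside  ∷ q) disjoint with () ← disjoint here here
∣p∪q∣≡∣p∣+∣q∣ (inside  ∷ p) (outside ∷ q) disjoint =
  cong suc (∣p∪q∣≡∣p∣+∣q∣ p q λ x∈p x∈q → disjoint (there x∈p) (there x∈q))
∣p∪q∣≡∣p∣+∣q∣ (outside ∷ p) (inside  ∷ q) disjoint = trans
  (cong suc (∣p∪q∣≡∣p∣+∣q∣ p q λ x∈p x∈q → disjoint (there x∈p) (there x∈q)))
  (sym (+-suc ∣ p ∣ ∣ q ∣))
∣p∪q∣≡∣p∣+∣q∣ (outside ∷ p) (outside ∷ q) disjoint =
  ∣p∪q∣≡∣p∣+∣q∣ p q λ x∈p x∈q → disjoint (there x∈p) (there x∈q)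

∣p∣≡∣p∩q∣+∣p─q∣ : ∀ (p q : Subset n) → ∣ p ∣ ≡ ∣ p ∩ q ∣ + ∣ p ─ q ∣
∣p∣≡∣p∩q∣+∣p─q∣ []            []            = refl
∣p∣≡∣p∩q∣+∣p─q∣ (inside  ∷ p) (inside  ∷ q) = cong suc (∣p∣≡∣p∩q∣+∣p─q∣ p q)
∣p∣≡∣p∩q∣+∣p─q∣ (inside  ∷ p) (outside ∷ q) =
  trans (cong suc (∣p∣≡∣p∩q∣+∣p─q∣ p q)) (sym (+-suc _ _))
∣p∣≡∣p∩q∣+∣p─q∣ (outside ∷ p) (inside  ∷ q) = ∣p∣≡∣p∩q∣+∣p─q∣ p q
∣p∣≡∣p∩q∣+∣p─q∣ (outside ∷ p) (outside ∷ q) = ∣p∣≡∣p∩q∣+∣p─q∣ p q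

q⊆p⇒p∩q≡q : ∀ {p q : Subset n} → q ⊆ p → p ∩ q ≡ q
q⊆p⇒p∩q≡q {p = p} {q} q⊆p = ⊆-antisym (p∩q⊆q p q) (λ x∈q → x∈p∩q⁺ (q⊆p x∈q , x∈q))

q⊆p⇒∣p∣≡∣q∣+∣p─q∣ : ∀ {p q : Subset n} → q ⊆ p → ∣ p ∣ ≡ ∣ q ∣ + ∣ p ─ q ∣
q⊆p⇒∣p∣≡∣q∣+∣p─q∣ {p = p} {q} q⊆p =
  trans (∣p∣≡∣p∩q∣+∣p─q∣ p q) (cong (λ r → ∣ r ∣ + ∣ p ─ q ∣) (q⊆p⇒p∩q≡q q⊆p))

x∉p⇒∣p∪⁅x⁆∣≡1+∣p∣ : ∀ {p : Subset n} → x ∉ p → ∣ p ∪ ⁅ x ⁆ ∣ ≡ suc ∣ p ∣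
x∉p⇒∣p∪⁅x⁆∣≡1+∣p∣ {x = x} {p} x∉p = begin
  ∣ p ∪ ⁅ x ⁆ ∣      ≡⟨ ∣p∪q∣≡∣p∣+∣q∣ p ⁅ x ⁆ (λ y∈p y∈⁅x⁆ → x∉p (subst (_∈ p) (x∈⁅y⁆⇒x≡y x y∈⁅x⁆) y∈p)) ⟩
  ∣ p ∣ + ∣ ⁅ x ⁆ ∣  ≡⟨ cong (∣ p ∣ +_) (∣⁅x⁆∣≡1 x) ⟩
  ∣ p ∣ + 1          ≡⟨ +-comm ∣ p ∣ 1 ⟩
  suc ∣ p ∣          ∎
  where open ≡-Reasoning

x∈p─q∧x∈r⇒∣p─r∣<∣p─q∣ : ∀ {p q r : Subset n} → q ⊆ r → x ∈ p ─ q → x ∈ r →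
  ∣ p ─ r ∣ < ∣ p ─ q ∣
x∈p─q∧x∈r⇒∣p─r∣<∣p─q∣ {x = x} {p} {q} {r} q⊆r x∈p─q x∈r =
  p⊂q⇒∣p∣<∣q∣ (p─r⊆p─q , x , x∈p─q , λ x∈p─r → x∈p─q⇒x∉q p r x∈p─r x∈r)
  where
  p─r⊆p─q : p ─ r ⊆ p ─ q
  p─r⊆p─q y∈p─r = x∈p∧x∉q⇒x∈p─q (p─q⊆p p r y∈p─r) (x∈p─q⇒x∉q p r y∈p─r ∘ q⊆r)

x∈p⇒⁅x⁆⊆p : ∀ {p : Subset n} → x ∈ p → ⁅ x ⁆ ⊆ p
x∈p⇒⁅x⁆⊆p {x = x} {p} x∈p y∈⁅x⁆ = subst (_∈ p) (sym (x∈⁅y⁆⇒x≡y x y∈⁅x⁆)) x∈p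

-- Odd minors

¬¬-pull-Fin : ∀ {t} {P : Fin t → Set} → (∀ i → ¬ ¬ P i) → ¬ ¬ (∀ i → P i)
¬¬-pull-Fin {zero}  ¬¬P k = k λ ()
¬¬-pull-Fin {suc t} ¬¬P k =
  ¬¬P zero λ P₀ → ¬¬-pull-Fin (¬¬P ∘ suc) λ Pₛ → k λ { zero → P₀ ; (suc i) → Pₛ i }

module Contraction {n t} {G : Graph n} (H : Subgraph G) (F : Fin n → Fin n → Set) (K : ContractsToK H F t)
  where
  open Subgraph H using (inV; inE; inE-ends)

  branch : (v : Fin n) → inV v → Fin t
  branch = proj₁ K

  branch-onto : ∀ i → ∃ λ v → Σ (inV v) λ p → branch v p ≡ i
  branch-onto = proj₁ (proj₂ K)

  branch-connected : ∀ u v (p : inV u) (q : inV v) →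
    (branch u p ≡ branch v q → Star F u v) × (Star F u v → branch u p ≡ branch v q)
  branch-connected = proj₁ (proj₂ (proj₂ K))

  branch-adjacent : ∀ i j → i ≢ j → ∃ λ u → ∃ λ v → Σ (inE u v) λ e →
    branch u (proj₁ (inE-ends e)) ≡ i × branch v (proj₂ (inE-ends e)) ≡ j
  branch-adjacent = proj₂ (proj₂ (proj₂ K))

CutEdge-sym : ∀ {n} {G : Graph n} (H : Subgraph G) (X : Fin n → Set) {u v} →
  CutEdge H X u v → CutEdge H X v u
CutEdge-sym H X (e , inj₁ (Xu , ¬Xv)) = Subgraph.inE-sym H e , inj₂ (¬Xv , Xu)
CutEdge-sym H X (e , inj₂ (¬Xu , Xv)) = Subgraph.inE-sym H e , inj₁ (Xv , ¬Xu)

module _ {n : ℕ} (G : Graph n) where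

  edge? : ∀ u v → Dec (Edge G u v)
  edge? u v = Graph.adj G u v Bool.≟ true

  edge-sym : ∀ {u v} → Edge G u v → Edge G v u
  edge-sym {u} {v} e = trans (Graph.sym G v u) e

  edge-irrefl : ∀ {v} → ¬ Edge G v v
  edge-irrefl {v} e with () ← trans (sym e) (Graph.irrefl G v)

  Independent : Subset n → Set
  Independent J = ∀ {u v} → u ∈ J → v ∈ J → ¬ Edge G u v

  ⁅x⁆-independent : ∀ v → Independent ⁅ v ⁆
  ⁅x⁆-independent v u∈⁅v⁆ w∈⁅v⁆
    with refl ← x∈⁅y⁆⇒x≡y v u∈⁅v⁆ | refl ← x∈⁅y⁆⇒x≡y v w∈⁅v⁆ = edge-irrefl

  adjacent? : ∀ I v → Dec (∃ λ x → x ∈ I × Edge G v x)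
  adjacent? I v = any? λ x → x ∈? I ×-dec edge? v x

  neighbourhood : Subset n → Subset n
  neighbourhood I = tabulate λ v → ⌊ adjacent? I v ⌋

  ∈-neighbourhood⁺ : ∀ {I v x} → x ∈ I → Edge G v x → v ∈ neighbourhood I
  ∈-neighbourhood⁺ {I} {v} {x} x∈I e = lookup⇒[]= v _ (trans (lookup∘tabulate _ v)
    (Equivalence.to Bool.T-≡ (fromWitness {a? = adjacent? I v} (x , x∈I , e))))

  ∈-neighbourhood⁻ : ∀ {I v} → v ∈ neighbourhood I → ∃ λ x → x ∈ I × Edge G v x
  ∈-neighbourhood⁻ {I} {v} v∈N =
    toWitness {a? = adjacent? I v}
      (Equivalence.from Bool.T-≡ (trans (sym (lookup∘tabulate _ v)) ([]=⇒lookup v∈N)))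

  OddMinorWithin : (Fin n → Set) → ℕ → Set₁
  OddMinorWithin S t = Σ (HasOddMinor G t) λ M → ∀ v → Subgraph.inV (proj₁ M) v → S v

  OddMinorWithin-mono : ∀ {P Q : Fin n → Set} {t} → (∀ {v} → P v → Q v) →
    OddMinorWithin P t → OddMinorWithin Q t
  OddMinorWithin-mono P⊆Q (M , within) = M , λ v p → P⊆Q (within v p)

  Crossing : (T Y : Fin n → Set) → Fin n → Fin n → Set
  Crossing T Y u v = Edge G u v × T u × T v × (Y u × ¬ Y v ⊎ ¬ Y u × Y v)

  Crossing-sym : ∀ {T Y u v} → Crossing T Y u v → Crossing T Y v u
  Crossing-sym (e , Tu , Tv , inj₁ (Yu , ¬Yv)) = edge-sym e , Tv , Tu , inj₂ (¬Yv , Yu)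
  Crossing-sym (e , Tu , Tv , inj₂ (¬Yu , Yv)) = edge-sym e , Tv , Tu , inj₁ (Yv , ¬Yu)

  Attachment : Subgraph G → (X T Y : Fin n → Set) → Fin n → Fin n → Set
  Attachment H X T Y u w = Subgraph.inV H u × T w × Edge G u w × (X u × Y w ⊎ ¬ X u × ¬ Y w)

  -- A set T spanned by edges crossing Y ⊆ T becomes one more branch set of an odd minor on
  -- H disjoint from T, with cut side X ∪ Y, provided each branch set has an edge to T
  -- that X ∪ Y does not cut.
  module AddBranchSet {t} {H : Subgraph G} {X : Fin n → Set} (X⊆H : ∀ v → X v → Subgraph.inV H v)
    (K : ContractsToK H (CutEdge H X) t)
    {T Y : Fin n → Set} (Y⊆T : ∀ {v} → Y v → T v) (T∩H=∅ : ∀ {v} → T v → ¬ Subgraph.inV H v)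
    {root : Fin n} (root∈T : T root) (spanning : ∀ {v} → T v → Star (Crossing T Y) v root) where

    open Subgraph H renaming (inV to V; inE to E; inE-sym to E-sym; inE-edge to E-edge; inE-ends to E-ends)
    open Contraction H (CutEdge H X) K

    V′ : Fin n → Set
    V′ v = V v ⊎ T v

    E′ : Fin n → Fin n → Set
    E′ u v = E u v ⊎ Crossing T Y u v ⊎ Attachment H X T Y u v ⊎ Attachment H X T Y v u

    E′-sym : ∀ {u v} → E′ u v → E′ v u
    E′-sym (inj₁ e)               = inj₁ (E-sym e)
    E′-sym (inj₂ (inj₁ c))        = inj₂ (inj₁ (Crossing-sym c))
    E′-sym (inj₂ (inj₂ (inj₁ a))) = inj₂ (inj₂ (inj₂ a))
    E′-sym (inj₂ (inj₂ (inj₂ a))) = inj₂ (inj₂ (inj₁ a))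

    E′-edge : ∀ {u v} → E′ u v → Edge G u v
    E′-edge (inj₁ e)                           = E-edge e
    E′-edge (inj₂ (inj₁ (e , _)))              = e
    E′-edge (inj₂ (inj₂ (inj₁ (_ , _ , e , _)))) = e
    E′-edge (inj₂ (inj₂ (inj₂ (_ , _ , e , _)))) = edge-sym e

    E′-ends : ∀ {u v} → E′ u v → V′ u × V′ v
    E′-ends (inj₁ e)                              = inj₁ (proj₁ (E-ends e)) , inj₁ (proj₂ (E-ends e))
    E′-ends (inj₂ (inj₁ (_ , Tu , Tv , _)))        = inj₂ Tu , inj₂ Tv
    E′-ends (inj₂ (inj₂ (inj₁ (Vu , Tv , _))))     = inj₁ Vu , inj₂ Tv
    E′-ends (inj₂ (inj₂ (inj₂ (Vv , Tu , _))))     = inj₂ Tu , inj₁ Vv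

    H′ : Subgraph G
    H′ = record { inV = V′ ; inE = E′ ; inE-sym = E′-sym ; inE-edge = E′-edge ; inE-ends = E′-ends }

    X′ : Fin n → Set
    X′ v = X v ⊎ Y v

    X′⊆H′ : ∀ v → X′ v → V′ v
    X′⊆H′ v (inj₁ Xv) = inj₁ (X⊆H v Xv)
    X′⊆H′ v (inj₂ Yv) = inj₂ (Y⊆T Yv)

    X′⇒X : ∀ {v} → V v → X′ v → X v
    X′⇒X _  (inj₁ Xv) = Xv
    X′⇒X Vv (inj₂ Yv) = ⊥-elim (T∩H=∅ (Y⊆T Yv) Vv)

    X′⇒Y : ∀ {v} → T v → X′ v → Y v
    X′⇒Y Tv (inj₁ Xv) = ⊥-elim (T∩H=∅ Tv (X⊆H _ Xv))
    X′⇒Y _  (inj₂ Yv) = Yv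

    cut⇒cut′ : ∀ {u v} → CutEdge H X u v → CutEdge H′ X′ u v
    cut⇒cut′ (e , inj₁ (Xu , ¬Xv)) = inj₁ e , inj₁ (inj₁ Xu , ¬Xv ∘ X′⇒X (proj₂ (E-ends e)))
    cut⇒cut′ (e , inj₂ (¬Xu , Xv)) = inj₁ e , inj₂ (¬Xu ∘ X′⇒X (proj₁ (E-ends e)) , inj₁ Xv)

    crossing⇒cut′ : ∀ {u v} → Crossing T Y u v → CutEdge H′ X′ u v
    crossing⇒cut′ c@(_ , Tu , Tv , inj₁ (Yu , ¬Yv)) = inj₂ (inj₁ c) , inj₁ (inj₂ Yu , ¬Yv ∘ X′⇒Y Tv)
    crossing⇒cut′ c@(_ , Tu , Tv , inj₂ (¬Yu , Yv)) = inj₂ (inj₁ c) , inj₂ (¬Yu ∘ X′⇒Y Tu , inj₂ Yv)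

    attachment-uncut : ∀ {u w} → Attachment H X T Y u w → ¬ (X′ u × ¬ X′ w ⊎ ¬ X′ u × X′ w)
    attachment-uncut (_  , _  , _ , inj₁ (Xu , Yw))   (inj₁ (_ , ¬X′w))  = ¬X′w (inj₂ Yw)
    attachment-uncut (_  , _  , _ , inj₁ (Xu , Yw))   (inj₂ (¬X′u , _))  = ¬X′u (inj₁ Xu)
    attachment-uncut (Vu , _  , _ , inj₂ (¬Xu , ¬Yw)) (inj₁ (X′u , _))   = ¬Xu (X′⇒X Vu X′u)
    attachment-uncut (_  , Tw , _ , inj₂ (¬Xu , ¬Yw)) (inj₂ (_ , X′w))   = ¬Yw (X′⇒Y Tw X′w)

    cut′⇒cut : ∀ {u v} → V u → CutEdge H′ X′ u v → CutEdge H X u v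
    cut′⇒cut Vu (inj₁ e , inj₁ (X′u , ¬X′v)) = e , inj₁ (X′⇒X Vu X′u , ¬X′v ∘ inj₁)
    cut′⇒cut Vu (inj₁ e , inj₂ (¬X′u , X′v)) = e , inj₂ (¬X′u ∘ inj₁ , X′⇒X (proj₂ (E-ends e)) X′v)
    cut′⇒cut Vu (inj₂ (inj₁ (_ , Tu , _)) , _)          = ⊥-elim (T∩H=∅ Tu Vu)
    cut′⇒cut Vu (inj₂ (inj₂ (inj₁ a)) , cut)            = ⊥-elim (attachment-uncut a cut)
    cut′⇒cut Vu (inj₂ (inj₂ (inj₂ (_ , Tu , _))) , _)   = ⊥-elim (T∩H=∅ Tu Vu)

    path′⇒path : ∀ {u v} → V u → Star (CutEdge H′ X′) u v → Star (CutEdge H X) u v × V v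
    path′⇒path Vu ε       = ε , Vu
    path′⇒path Vu (c ◅ p) =
      let c′ = cut′⇒cut Vu c
          p′ , Vv = path′⇒path (proj₂ (E-ends (proj₁ c′))) p
      in c′ ◅ p′ , Vv

    T-path : ∀ {u v} → T u → T v → Star (CutEdge H′ X′) u v
    T-path Tu Tv = Star.map crossing⇒cut′ (spanning Tu ◅◅ Star.reverse Crossing-sym (spanning Tv))

    branch′ : (v : Fin n) → V′ v → Fin (suc t)
    branch′ v (inj₁ Vv) = suc (branch v Vv)
    branch′ v (inj₂ _)  = zero

    branch′-onto : ∀ i → ∃ λ v → Σ (V′ v) λ p → branch′ v p ≡ i
    branch′-onto zero    = root , inj₂ root∈T , refl
    branch′-onto (suc i) with branch-onto i
    ... | v , Vv , refl = v , inj₁ Vv , refl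

    branch′-connected : ∀ u v (p : V′ u) (q : V′ v) →
      (branch′ u p ≡ branch′ v q → Star (CutEdge H′ X′) u v) ×
      (Star (CutEdge H′ X′) u v → branch′ u p ≡ branch′ v q)
    branch′-connected u v (inj₁ p) (inj₁ q) =
      Star.map cut⇒cut′ ∘ proj₁ (branch-connected u v p q) ∘ Fin.suc-injective ,
      cong suc ∘ proj₂ (branch-connected u v p q) ∘ proj₁ ∘ path′⇒path p
    branch′-connected u v (inj₂ p) (inj₂ q) = (λ _ → T-path p q) , (λ _ → refl)
    branch′-connected u v (inj₁ p) (inj₂ q) =
      (λ ()) , λ path → ⊥-elim (T∩H=∅ q (proj₂ (path′⇒path p path)))
    branch′-connected u v (inj₂ p) (inj₁ q) = (λ ()) , λ path →
      ⊥-elim (T∩H=∅ p (proj₂ (path′⇒path q (Star.reverse (CutEdge-sym H′ X′) path))))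

    module _ (attachments : ∀ i → ∃ λ u → ∃ λ w → Σ (Attachment H X T Y u w) λ a → branch u (proj₁ a) ≡ i)
      where

      branch′-adjacent : ∀ i j → i ≢ j → ∃ λ u → ∃ λ v → Σ (E′ u v) λ e →
        branch′ u (proj₁ (E′-ends e)) ≡ i × branch′ v (proj₂ (E′-ends e)) ≡ j
      branch′-adjacent zero    zero    i≢j = ⊥-elim (i≢j refl)
      branch′-adjacent (suc i) (suc j) i≢j with branch-adjacent i j (i≢j ∘ cong suc)
      ... | u , v , e , refl , refl = u , v , inj₁ e , refl , refl
      branch′-adjacent (suc i) zero    _ with attachments i
      ... | u , w , a , refl = u , w , inj₂ (inj₂ (inj₁ a)) , refl , refl
      branch′-adjacent zero    (suc j) _ with attachments j
      ... | u , w , a , refl = w , u , inj₂ (inj₂ (inj₂ a)) , refl , refl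

      oddMinor : OddMinorWithin V′ (suc t)
      oddMinor =
        (H′ , X′ , X′⊆H′ , branch′ , branch′-onto , branch′-connected , branch′-adjacent) , λ _ p → p

  module BranchSides {t} {H : Subgraph G} {X : Fin n → Set} (K : ContractsToK H (CutEdge H X) t) where

    open Subgraph H renaming (inV to V; inE-ends to E-ends)
    open Contraction H (CutEdge H X) K
    open RawMonad (¬¬-Monad {a = 0ℓ})

    Meets : (Fin n → Set) → Fin t → Set
    Meets P i = ∃ λ u → Σ (V u) λ Vu → branch u Vu ≡ i × P u

    Singleton : ∀ u → V u → Set
    Singleton u Vu = ∀ w (Vw : V w) → branch w Vw ≡ branch u Vu → w ≡ u

    -- The first edge of a path joining two vertices of a branch set is cut.
    meetsBoth : ∀ {u w} (Vu : V u) (Vw : V w) → branch w Vw ≡ branch u Vu → w ≢ u →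
      Meets X (branch u Vu) × Meets (¬_ ∘ X) (branch u Vu)
    meetsBoth {u} {w} Vu Vw same w≢u = firstEdge (proj₁ (branch-connected u w Vu Vw) (sym same))
      where
      firstEdge : Star (CutEdge H X) u w → Meets X (branch u Vu) × Meets (¬_ ∘ X) (branch u Vu)
      firstEdge ε = ⊥-elim (w≢u refl)
      firstEdge (_◅_ {j = v} (e , sides) _) with proj₂ (E-ends e)
      ... | Vv with sym (proj₂ (branch-connected u v Vu Vv) ((e , sides) ◅ ε)) | sides
      ...   | same-v | inj₁ (Xu , ¬Xv) = (u , Vu , refl , Xu) , (v , Vv , same-v , ¬Xv)
      ...   | same-v | inj₂ (¬Xu , Xv) = (v , Vv , same-v , Xv) , (u , Vu , refl , ¬Xu)

    singleton-or-meetsBoth : ∀ u (Vu : V u) →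
      ¬ ¬ (Singleton u Vu ⊎ Meets X (branch u Vu) × Meets (¬_ ∘ X) (branch u Vu))
    singleton-or-meetsBoth u Vu = do
      other? ← ¬¬-excluded-middle {A = ∃ λ w → Σ (V w) λ Vw → branch w Vw ≡ branch u Vu × w ≢ u}
      pure (decide other?)
      where
      decide : Dec (∃ λ w → Σ (V w) λ Vw → branch w Vw ≡ branch u Vu × w ≢ u) →
        Singleton u Vu ⊎ Meets X (branch u Vu) × Meets (¬_ ∘ X) (branch u Vu)
      decide (yes (w , Vw , same , w≢u)) = inj₂ (meetsBoth Vu Vw same w≢u)
      decide (no none) = inj₁ λ w Vw same → decidable-stable (w Fin.≟ u) λ w≢u → none (w , Vw , same , w≢u)

    -- Two singleton branch sets on opposite sides would be joined by a cut edge.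
    singletons-sameSide : ∀ {u w} {Vu : V u} {Vw : V w} → Singleton u Vu → Singleton w Vw → X u → ¬ X w → ⊥
    singletons-sameSide {u} {w} {Vu} {Vw} single-u single-w Xu ¬Xw with branch u Vu Fin.≟ branch w Vw
    ... | yes same = ¬Xw (subst X (single-w u Vu same) Xu)
    ... | no differ with branch-adjacent (branch u Vu) (branch w Vw) differ
    ...   | a , b , e , in-u , in-w = differ (begin
      branch u Vu                  ≡⟨ in-u ⟨
      branch a (proj₁ (E-ends e))  ≡⟨ proj₂ (branch-connected a b _ _) (cut ◅ ε) ⟩
      branch b (proj₂ (E-ends e))  ≡⟨ in-w ⟩
      branch w Vw                  ∎)
      where
      open ≡-Reasoning
      cut : CutEdge H X a b
      cut = e , inj₁ (subst X (sym (single-u a _ in-u)) Xu , ¬Xw ∘ subst X (single-w b _ in-w))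

    oneSideMet : ¬ ¬ ((∀ i → Meets X i) ⊎ (∀ i → Meets (¬_ ∘ X) i))
    oneSideMet = do
      singletonInX? ← ¬¬-excluded-middle {A = ∃ λ u → Σ (V u) λ Vu → Singleton u Vu × X u}
      case singletonInX? of λ
        { (yes (u , Vu , single-u , Xu)) → inj₁ <$> ¬¬-pull-Fin (meetsX single-u Xu)
        ; (no none) → inj₂ <$> ¬¬-pull-Fin (meets¬X none) }
      where
      meetsX : ∀ {u} {Vu : V u} → Singleton u Vu → X u → ∀ i → ¬ ¬ Meets X i
      meetsX single-u Xu i with branch-onto i
      ... | v , Vv , refl = do
        kind ← singleton-or-meetsBoth v Vv
        case kind of λ
          { (inj₂ (found , _)) → pure found
          ; (inj₁ single-v) → (λ Xv → v , Vv , refl , Xv) <$> singletons-sameSide single-u single-v Xu }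
      meets¬X : ¬ (∃ λ u → Σ (V u) λ Vu → Singleton u Vu × X u) → ∀ i → ¬ ¬ Meets (¬_ ∘ X) i
      meets¬X none i with branch-onto i
      ... | v , Vv , refl = do
        kind ← singleton-or-meetsBoth v Vv
        case kind of λ
          { (inj₂ (_ , found)) → pure found
          ; (inj₁ single-v) → pure (v , Vv , refl , λ Xv → none (v , Vv , single-v , Xv)) }

  -- Growing a connected bipartite set

  TreeEdge : Subset n → Subset n → Fin n → Fin n → Set
  TreeEdge I C u v = Edge G u v × (u ∈ I × v ∈ C ⊎ u ∈ C × v ∈ I)

  TreeEdge-mono : ∀ {I I′ C C′ u v} → I ⊆ I′ → C ⊆ C′ → TreeEdge I C u v → TreeEdge I′ C′ u v
  TreeEdge-mono I⊆I′ C⊆C′ (e , inj₁ (u∈I , v∈C)) = e , inj₁ (I⊆I′ u∈I , C⊆C′ v∈C)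
  TreeEdge-mono I⊆I′ C⊆C′ (e , inj₂ (u∈C , v∈I)) = e , inj₂ (C⊆C′ u∈C , I⊆I′ v∈I)

  record ConnectedBipartite (I C : Subset n) : Set where
    field
      root      : Fin n
      root∈I    : root ∈ I
      disjoint  : ∀ {v} → v ∈ I → v ∉ C
      connected : ∀ {v} → v ∈ I ⊎ v ∈ C → Star (TreeEdge I C) v root

  module _ {I C : Subset n} (tree : ConnectedBipartite I C) where
    open ConnectedBipartite tree

    private
      T : Fin n → Set
      T v = v ∈ I ⊎ v ∈ C

    TreeEdge⇒Crossing-I : ∀ {u v} → TreeEdge I C u v → Crossing T (_∈ I) u v
    TreeEdge⇒Crossing-I (e , inj₁ (u∈I , v∈C)) =
      e , inj₁ u∈I , inj₂ v∈C , inj₁ (u∈I , λ v∈I → disjoint v∈I v∈C)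
    TreeEdge⇒Crossing-I (e , inj₂ (u∈C , v∈I)) =
      e , inj₂ u∈C , inj₁ v∈I , inj₂ ((λ u∈I → disjoint u∈I u∈C) , v∈I)

    TreeEdge⇒Crossing-C : ∀ {u v} → TreeEdge I C u v → Crossing T (_∈ C) u v
    TreeEdge⇒Crossing-C (e , inj₁ (u∈I , v∈C)) = e , inj₁ u∈I , inj₂ v∈C , inj₂ (disjoint u∈I , v∈C)
    TreeEdge⇒Crossing-C (e , inj₂ (u∈C , v∈I)) = e , inj₂ u∈C , inj₁ v∈I , inj₁ (u∈C , disjoint v∈I)

    -- I ∪ C becomes a new branch set, cut along I if every branch set meets X and along C if
    -- every branch set meets its complement; one of the two holds classically.
    attached-noOddMinor : ∀ {A : Subset n} {t} → (∀ {v} → v ∈ A → ¬ T v) →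
      (∀ {v} → v ∈ A → ∃ λ x → x ∈ I × Edge G v x) →
      ¬ OddMinorWithin (λ v → v ∈ A ⊎ T v) (suc t) → ¬ OddMinorWithin (_∈ A) t
    attached-noOddMinor {A} A∩T=∅ A→I noMinor ((H , X , X⊆H , K) , H⊆A) = oneSideMet λ
      { (inj₁ allMeetX)  → extendAlong inj₁ TreeEdge⇒Crossing-I
                             (attach allMeetX λ x∈I Xu → inj₁ (Xu , x∈I))
      ; (inj₂ allMeet¬X) → extendAlong inj₂ TreeEdge⇒Crossing-C
                             (attach allMeet¬X λ x∈I ¬Xu → inj₂ (¬Xu , disjoint x∈I)) }
      where
      open BranchSides {H = H} {X} K
      open Contraction H (CutEdge H X) K using (branch)
      V = Subgraph.inV H
      Attachments : (Fin n → Set) → Set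
      Attachments Y = ∀ i → ∃ λ u → ∃ λ w → Σ (Attachment H X T Y u w) λ a → branch u (proj₁ a) ≡ i
      T∩H=∅ : ∀ {v} → T v → ¬ V v
      T∩H=∅ Tv Vv = A∩T=∅ (H⊆A _ Vv) Tv
      widen : ∀ {v} → V v ⊎ T v → v ∈ A ⊎ T v
      widen (inj₁ Vv) = inj₁ (H⊆A _ Vv)
      widen (inj₂ Tv) = inj₂ Tv
      extendAlong : ∀ {Y} → (∀ {v} → Y v → T v) → (∀ {u v} → TreeEdge I C u v → Crossing T Y u v) →
        Attachments Y → ⊥
      extendAlong Y⊆T crossing attachments = noMinor (OddMinorWithin-mono widen
        (AddBranchSet.oddMinor {H = H} {X} X⊆H K Y⊆T T∩H=∅ (inj₁ root∈I) (Star.map crossing ∘ connected)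
           attachments))
      attach : ∀ {P Y : Fin n → Set} → (∀ i → Meets P i) →
        (∀ {u x} → x ∈ I → P u → X u × Y x ⊎ ¬ X u × ¬ Y x) → Attachments Y
      attach meets sides i with meets i
      ... | u , Vu , in-i , Pu with A→I (H⊆A u Vu)
      ...   | x , x∈I , e = u , x , (Vu , inj₁ x∈I , e , sides x∈I Pu) , in-i

  ConnectedBipartite-addI : ∀ {I C w c} → ConnectedBipartite I C → w ∉ C → c ∈ C → Edge G w c →
    ConnectedBipartite (I ∪ ⁅ w ⁆) C
  ConnectedBipartite-addI {I} {C} {w} {c} tree w∉C c∈C e = record
    { root      = root
    ; root∈I    = p⊆p∪q ⁅ w ⁆ root∈I
    ; disjoint  = λ v∈I′ → [ disjoint , (λ v∈⁅w⁆ → subst (_∉ C) (sym (x∈⁅y⁆⇒x≡y w v∈⁅w⁆)) w∉C) ]′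
                        (x∈p∪q⁻ I ⁅ w ⁆ v∈I′)
    ; connected = connected′
    }
    where
    open ConnectedBipartite tree
    lift : ∀ {u v} → Star (TreeEdge I C) u v → Star (TreeEdge (I ∪ ⁅ w ⁆) C) u v
    lift = Star.map (TreeEdge-mono (p⊆p∪q ⁅ w ⁆) id)
    connected′ : ∀ {v} → v ∈ I ∪ ⁅ w ⁆ ⊎ v ∈ C → Star (TreeEdge (I ∪ ⁅ w ⁆) C) v root
    connected′ (inj₂ v∈C) = lift (connected (inj₂ v∈C))
    connected′ (inj₁ v∈I′) with x∈p∪q⁻ I ⁅ w ⁆ v∈I′
    ... | inj₁ v∈I = lift (connected (inj₁ v∈I))
    ... | inj₂ v∈⁅w⁆ with refl ← x∈⁅y⁆⇒x≡y w v∈⁅w⁆ =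
      (e , inj₁ (q⊆p∪q I ⁅ w ⁆ (x∈⁅x⁆ w) , c∈C)) ◅ lift (connected (inj₂ c∈C))

  ConnectedBipartite-addC : ∀ {I C u x} → ConnectedBipartite I C → u ∉ I → x ∈ I → Edge G u x →
    ConnectedBipartite I (C ∪ ⁅ u ⁆)
  ConnectedBipartite-addC {I} {C} {u} {x} tree u∉I x∈I e = record
    { root      = root
    ; root∈I    = root∈I
    ; disjoint  = λ v∈I v∈C′ → [ disjoint v∈I , (λ v∈⁅u⁆ → u∉I (subst (_∈ I) (x∈⁅y⁆⇒x≡y u v∈⁅u⁆) v∈I)) ]′
                                (x∈p∪q⁻ C ⁅ u ⁆ v∈C′)
    ; connected = connected′
    }
    where
    open ConnectedBipartite tree
    lift : ∀ {v w} → Star (TreeEdge I C) v w → Star (TreeEdge I (C ∪ ⁅ u ⁆)) v w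
    lift = Star.map (TreeEdge-mono id (p⊆p∪q ⁅ u ⁆))
    connected′ : ∀ {v} → v ∈ I ⊎ v ∈ C ∪ ⁅ u ⁆ → Star (TreeEdge I (C ∪ ⁅ u ⁆)) v root
    connected′ (inj₁ v∈I) = lift (connected (inj₁ v∈I))
    connected′ (inj₂ v∈C′) with x∈p∪q⁻ C ⁅ u ⁆ v∈C′
    ... | inj₁ v∈C = lift (connected (inj₂ v∈C))
    ... | inj₂ v∈⁅u⁆ with refl ← x∈⁅y⁆⇒x≡y u v∈⁅u⁆ =
      (e , inj₂ (q⊆p∪q C ⁅ u ⁆ (x∈⁅x⁆ u) , x∈I)) ◅ lift (connected (inj₁ x∈I))

  record GrowingTree (S : Subset n) : Set where
    field
      I C         : Subset n
      bipartite   : ConnectedBipartite I C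
      I⊆S         : I ⊆ S
      C⊆S         : C ⊆ S
      independent : Independent I
      ∣C∣<∣I∣      : ∣ C ∣ < ∣ I ∣

    open ConnectedBipartite bipartite public

    rest : Subset n
    rest = S ─ (I ∪ C)

    attached : Subset n
    attached = rest ∩ neighbourhood I

    remote : Subset n
    remote = rest ─ neighbourhood I

    ∈rest⁻ : ∀ {v} → v ∈ rest → v ∈ S × ¬ (v ∈ I ⊎ v ∈ C)
    ∈rest⁻ v∈rest = p─q⊆p S (I ∪ C) v∈rest , x∈p─q⇒x∉q S (I ∪ C) v∈rest ∘ x∈p∪q⁺

    ∈attached⁻ : ∀ {v} → v ∈ attached → v ∈ rest × ∃ λ x → x ∈ I × Edge G v x
    ∈attached⁻ v∈A with x∈p∩q⁻ rest (neighbourhood I) v∈A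
    ... | v∈rest , v∈N = v∈rest , ∈-neighbourhood⁻ v∈N

    ∈remote⁻ : ∀ {v} → v ∈ remote → v ∈ rest × ∀ {x} → x ∈ I → ¬ Edge G v x
    ∈remote⁻ v∈R = p─q⊆p rest _ v∈R , λ x∈I e → x∈p─q⇒x∉q rest _ v∈R (∈-neighbourhood⁺ x∈I e)

  module _ {S : Subset n} (tree : GrowingTree S) where
    open GrowingTree tree

    addRemote : ∀ {w C′} → w ∈ remote → C ⊆ C′ → C′ ⊆ S → ∣ C′ ∣ ≤ suc ∣ C ∣ →
      ConnectedBipartite (I ∪ ⁅ w ⁆) C′ → Σ (GrowingTree S) λ tree′ → ∣ GrowingTree.rest tree′ ∣ < ∣ rest ∣
    addRemote {w} {C′} w∈R C⊆C′ C′⊆S ∣C′∣≤1+∣C∣ bipartite′ = tree′ , shrinks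
      where
      w∈rest = proj₁ (∈remote⁻ w∈R)
      w∉I⊎C = proj₂ (∈rest⁻ w∈rest)
      I′ = I ∪ ⁅ w ⁆
      in-I′ : ∀ {v} → v ∈ I′ → v ∈ I ⊎ v ≡ w
      in-I′ v∈I′ = [ inj₁ , inj₂ ∘ x∈⁅y⁆⇒x≡y w ]′ (x∈p∪q⁻ I ⁅ w ⁆ v∈I′)
      independent′ : Independent I′
      independent′ u∈I′ v∈I′ with in-I′ u∈I′ | in-I′ v∈I′
      ... | inj₁ u∈I  | inj₁ v∈I  = independent u∈I v∈I
      ... | inj₁ u∈I  | inj₂ refl = proj₂ (∈remote⁻ w∈R) u∈I ∘ edge-sym
      ... | inj₂ refl | inj₁ v∈I  = proj₂ (∈remote⁻ w∈R) v∈I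
      ... | inj₂ refl | inj₂ refl = edge-irrefl
      tree′ : GrowingTree S
      tree′ = record
        { I = I′ ; C = C′ ; bipartite = bipartite′
        ; I⊆S = λ v∈I′ → [ I⊆S , (λ { refl → proj₁ (∈rest⁻ w∈rest) }) ]′ (in-I′ v∈I′)
        ; C⊆S = C′⊆S
        ; independent = independent′
        ; ∣C∣<∣I∣ = ≤-<-trans ∣C′∣≤1+∣C∣
            (subst (suc ∣ C ∣ <_) (sym (x∉p⇒∣p∪⁅x⁆∣≡1+∣p∣ (w∉I⊎C ∘ inj₁))) (s≤s ∣C∣<∣I∣))
        }
      I∪C⊆I′∪C′ : I ∪ C ⊆ I′ ∪ C′
      I∪C⊆I′∪C′ v∈I∪C = [ p⊆p∪q C′ ∘ p⊆p∪q ⁅ w ⁆ , q⊆p∪q I′ C′ ∘ C⊆C′ ]′ (x∈p∪q⁻ I C v∈I∪C)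
      shrinks : ∣ S ─ (I′ ∪ C′) ∣ < ∣ rest ∣
      shrinks = x∈p─q∧x∈r⇒∣p─r∣<∣p─q∣ I∪C⊆I′∪C′ w∈rest (p⊆p∪q C′ (q⊆p∪q I ⁅ w ⁆ (x∈⁅x⁆ w)))

    addRemoteNextToC : ∀ {w c} → w ∈ remote → c ∈ C → Edge G w c →
      Σ (GrowingTree S) λ tree′ → ∣ GrowingTree.rest tree′ ∣ < ∣ rest ∣
    addRemoteNextToC w∈R c∈C e = addRemote w∈R id C⊆S (n≤1+n _)
      (ConnectedBipartite-addI bipartite (proj₂ (∈rest⁻ (proj₁ (∈remote⁻ w∈R))) ∘ inj₂) c∈C e)

    addRemoteNextToAttached : ∀ {w u} → w ∈ remote → u ∈ attached → Edge G w u →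
      Σ (GrowingTree S) λ tree′ → ∣ GrowingTree.rest tree′ ∣ < ∣ rest ∣
    addRemoteNextToAttached {w} {u} w∈R u∈A e with ∈attached⁻ u∈A
    ... | u∈rest , x , x∈I , ux = addRemote w∈R (p⊆p∪q ⁅ u ⁆) C′⊆S
      (≤-reflexive (x∉p⇒∣p∪⁅x⁆∣≡1+∣p∣ (u∉I⊎C ∘ inj₂)))
      (ConnectedBipartite-addI (ConnectedBipartite-addC bipartite (u∉I⊎C ∘ inj₁) x∈I ux)
         w∉C′ (q⊆p∪q C ⁅ u ⁆ (x∈⁅x⁆ u)) e)
      where
      u∉I⊎C = proj₂ (∈rest⁻ u∈rest)
      C′⊆S : C ∪ ⁅ u ⁆ ⊆ S
      C′⊆S v∈C′ = [ C⊆S , x∈p⇒⁅x⁆⊆p (proj₁ (∈rest⁻ u∈rest)) ]′ (x∈p∪q⁻ C ⁅ u ⁆ v∈C′)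
      w∉C′ : w ∉ C ∪ ⁅ u ⁆
      w∉C′ w∈C′ with x∈p∪q⁻ C ⁅ u ⁆ w∈C′
      ... | inj₁ w∈C = proj₂ (∈rest⁻ (proj₁ (∈remote⁻ w∈R))) (inj₂ w∈C)
      ... | inj₂ w∈⁅u⁆ with refl ← x∈⁅y⁆⇒x≡y u w∈⁅u⁆ = proj₂ (∈remote⁻ w∈R) x∈I ux

    remoteEdgeTo? : ∀ U → Dec (∃ λ w → w ∈ remote × ∃ λ u → u ∈ U × Edge G w u)
    remoteEdgeTo? U = any? λ w → w ∈? remote ×-dec any? λ u → u ∈? U ×-dec edge? w u

  record MaximalTree (S : Subset n) : Set where
    field
      tree : GrowingTree S
    open GrowingTree tree public
    field
      remote-C        : ∀ {w c} → w ∈ remote → c ∈ C → ¬ Edge G w c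
      remote-attached : ∀ {w u} → w ∈ remote → u ∈ attached → ¬ Edge G w u

  grow : ∀ {S} (tree : GrowingTree S) → Acc _<_ ∣ GrowingTree.rest tree ∣ → MaximalTree S
  grow tree (acc smaller) with remoteEdgeTo? tree (GrowingTree.C tree)
  ... | yes (w , w∈R , c , c∈C , e) with addRemoteNextToC tree w∈R c∈C e
  ...   | tree′ , shrinks = grow tree′ (smaller shrinks)
  grow tree (acc smaller) | no noC with remoteEdgeTo? tree (GrowingTree.attached tree)
  ... | yes (w , w∈R , u , u∈A , e) with addRemoteNextToAttached tree w∈R u∈A e
  ...   | tree′ , shrinks = grow tree′ (smaller shrinks)
  grow tree (acc smaller) | no noC | no noA = record
    { tree            = tree
    ; remote-C        = λ w∈R c∈C e → noC (_ , w∈R , _ , c∈C , e)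
    ; remote-attached = λ w∈R u∈A e → noA (_ , w∈R , _ , u∈A , e)
    }

  singletonTree : ∀ {S v} → v ∈ S → GrowingTree S
  singletonTree {S} {v} v∈S = record
    { I           = ⁅ v ⁆
    ; C           = ∅
    ; bipartite   = record
      { root      = v
      ; root∈I    = x∈⁅x⁆ v
      ; disjoint  = λ _ → ∉⊥
      ; connected = λ { (inj₁ u∈⁅v⁆) → subst (λ u → Star _ u v) (sym (x∈⁅y⁆⇒x≡y v u∈⁅v⁆)) ε
                      ; (inj₂ u∈∅) → ⊥-elim (∉⊥ u∈∅) }
      }
    ; I⊆S         = x∈p⇒⁅x⁆⊆p v∈S
    ; C⊆S         = ⊥-elim ∘ ∉⊥
    ; independent = ⁅x⁆-independent v
    ; ∣C∣<∣I∣      = subst₂ _<_ (sym (∣⊥∣≡0 n)) (sym (∣⁅x⁆∣≡1 v)) (s≤s z≤n)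
    }

  ∣S∣≡∣I∣+∣C∣+∣attached∣+∣remote∣ : ∀ {S} (tree : GrowingTree S) → let open GrowingTree tree in
    ∣ S ∣ ≡ ∣ I ∣ + ∣ C ∣ + (∣ attached ∣ + ∣ remote ∣)
  ∣S∣≡∣I∣+∣C∣+∣attached∣+∣remote∣ {S} tree = begin
    ∣ S ∣
      ≡⟨ q⊆p⇒∣p∣≡∣q∣+∣p─q∣ I∪C⊆S ⟩
    ∣ I ∪ C ∣ + ∣ rest ∣
      ≡⟨ cong₂ _+_ (∣p∪q∣≡∣p∣+∣q∣ I C disjoint) (∣p∣≡∣p∩q∣+∣p─q∣ rest (neighbourhood I)) ⟩
    ∣ I ∣ + ∣ C ∣ + (∣ attached ∣ + ∣ remote ∣)
      ∎
    where
    open ≡-Reasoning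
    open GrowingTree tree
    I∪C⊆S : I ∪ C ⊆ S
    I∪C⊆S v∈I∪C = [ I⊆S , C⊆S ]′ (x∈p∪q⁻ I C v∈I∪C)

  -- Large independent sets

  record LargeIndependentSet (S : Subset n) (L : ℕ) : Set where
    constructor largeIndependentSet
    field
      J           : Subset n
      J⊆S         : J ⊆ S
      independent : Independent J
      ∣S∣≤L∣J∣    : ∣ S ∣ ≤ L * ∣ J ∣

  Empty⇒LargeIndependentSet : ∀ {S L} → Empty S → LargeIndependentSet S L
  Empty⇒LargeIndependentSet {S} {L} empty =
    largeIndependentSet ∅ (⊥-elim ∘ ∉⊥) (λ u∈∅ _ → ⊥-elim (∉⊥ u∈∅))
      (subst (_≤ L * ∣ ∅ {n = n} ∣) (sym (trans (cong ∣_∣ (Empty-unique empty)) (∣⊥∣≡0 n))) z≤n)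

  Independent-∪ : ∀ {J J′} → Independent J → Independent J′ →
    (∀ {u v} → u ∈ J → v ∈ J′ → ¬ Edge G u v) → Independent (J ∪ J′)
  Independent-∪ {J} {J′} indep indep′ apart u∈ v∈ with x∈p∪q⁻ J J′ u∈ | x∈p∪q⁻ J J′ v∈
  ... | inj₁ u∈J  | inj₁ v∈J  = indep u∈J v∈J
  ... | inj₁ u∈J  | inj₂ v∈J′ = apart u∈J v∈J′
  ... | inj₂ u∈J′ | inj₁ v∈J  = apart v∈J u∈J′ ∘ edge-sym
  ... | inj₂ u∈J′ | inj₂ v∈J′ = indep′ u∈J′ v∈J′

  partition-bound : ∀ {i c a r j₀ jR L} → c < i → i ≤ j₀ → a ≤ L * j₀ → r ≤ (2 + L) * jR →
    i + c + (a + r) ≤ (2 + L) * (jR + j₀)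
  partition-bound {i} {c} {a} {r} {j₀} {jR} {L} c<i i≤j₀ a≤Lj₀ r≤[2+L]jR = begin
    i + c + (a + r)
      ≤⟨ +-mono-≤ (+-mono-≤ i≤j₀ (≤-trans (<⇒≤ c<i) i≤j₀)) (+-mono-≤ a≤Lj₀ r≤[2+L]jR) ⟩
    j₀ + j₀ + (L * j₀ + (2 + L) * jR)
      ≡⟨ regroup j₀ L jR ⟩
    (2 + L) * (jR + j₀)
      ∎
    where
    open ≤-Reasoning
    regroup : ∀ j L r → j + j + (L * j + (2 + L) * r) ≡ (2 + L) * (r + j)
    regroup = solve-∀

  module _ {S : Subset n} {L : ℕ} (mt : MaximalTree S) where
    open MaximalTree mt

    private
      I⊎A : Fin n → Set
      I⊎A v = v ∈ I ⊎ v ∈ attached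

    remote-separated : ∀ {w v} → w ∈ remote → I⊎A v → ¬ Edge G w v
    remote-separated w∈R (inj₁ v∈I) = proj₂ (∈remote⁻ w∈R) v∈I
    remote-separated w∈R (inj₂ v∈A) = remote-attached w∈R v∈A

    MaximalTree-combine : ∀ {J₀ JR} → (∀ {v} → v ∈ J₀ → I⊎A v) → Independent J₀ → ∣ I ∣ ≤ ∣ J₀ ∣ →
      ∣ attached ∣ ≤ L * ∣ J₀ ∣ → JR ⊆ remote → Independent JR → ∣ remote ∣ ≤ (2 + L) * ∣ JR ∣ →
      LargeIndependentSet S (2 + L)
    MaximalTree-combine {J₀} {JR} J₀⊆I⊎A J₀-indep ∣I∣≤∣J₀∣ ∣A∣≤L∣J₀∣ JR⊆R JR-indep ∣R∣≤[2+L]∣JR∣ =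
      largeIndependentSet (JR ∪ J₀) J⊆S
        (Independent-∪ JR-indep J₀-indep λ w∈JR v∈J₀ → remote-separated (JR⊆R w∈JR) (J₀⊆I⊎A v∈J₀))
        (begin
          ∣ S ∣
            ≡⟨ ∣S∣≡∣I∣+∣C∣+∣attached∣+∣remote∣ tree ⟩
          ∣ I ∣ + ∣ C ∣ + (∣ attached ∣ + ∣ remote ∣)
            ≤⟨ partition-bound {jR = ∣ JR ∣} {L = L} ∣C∣<∣I∣ ∣I∣≤∣J₀∣ ∣A∣≤L∣J₀∣ ∣R∣≤[2+L]∣JR∣ ⟩
          (2 + L) * (∣ JR ∣ + ∣ J₀ ∣)
            ≡⟨ cong ((2 + L) *_) (∣p∪q∣≡∣p∣+∣q∣ JR J₀ JR∩J₀=∅) ⟨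
          (2 + L) * ∣ JR ∪ J₀ ∣
            ∎)
      where
      open ≤-Reasoning
      I⊎A⊆S : ∀ {v} → I⊎A v → v ∈ S
      I⊎A⊆S (inj₁ v∈I) = I⊆S v∈I
      I⊎A⊆S (inj₂ v∈A) = proj₁ (∈rest⁻ (proj₁ (∈attached⁻ v∈A)))
      J⊆S : JR ∪ J₀ ⊆ S
      J⊆S v∈J = [ proj₁ ∘ ∈rest⁻ ∘ proj₁ ∘ ∈remote⁻ ∘ JR⊆R , I⊎A⊆S ∘ J₀⊆I⊎A ]′ (x∈p∪q⁻ JR J₀ v∈J)
      JR∩J₀=∅ : ∀ {v} → v ∈ JR → v ∉ J₀
      JR∩J₀=∅ v∈JR v∈J₀ with JR⊆R v∈JR | J₀⊆I⊎A v∈J₀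
      ... | v∈R | inj₁ v∈I = proj₂ (∈rest⁻ (proj₁ (∈remote⁻ v∈R))) (inj₁ v∈I)
      ... | v∈R | inj₂ v∈A with ∈attached⁻ v∈A
      ...   | _ , x , x∈I , e = proj₂ (∈remote⁻ v∈R) x∈I e

    MaximalTree-independent : LargeIndependentSet attached L → LargeIndependentSet remote (2 + L) →
      LargeIndependentSet S (2 + L)
    MaximalTree-independent (largeIndependentSet JA JA⊆A JA-indep ∣A∣≤L∣JA∣)
                            (largeIndependentSet JR JR⊆R JR-indep ∣R∣≤)
      with ∣ I ∣ ≤? ∣ JA ∣
    ... | yes ∣I∣≤∣JA∣ = MaximalTree-combine (inj₂ ∘ JA⊆A) JA-indep ∣I∣≤∣JA∣ ∣A∣≤L∣JA∣ JR⊆R JR-indep ∣R∣≤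
    ... | no ∣I∣≰∣JA∣ = MaximalTree-combine inj₁ independent ≤-refl
      (≤-trans ∣A∣≤L∣JA∣ (*-monoʳ-≤ L (<⇒≤ (≰⇒> ∣I∣≰∣JA∣)))) JR⊆R JR-indep ∣R∣≤

  emptyOddMinor : ∀ {P} → OddMinorWithin P 0
  emptyOddMinor = (H , (λ _ → ⊥) , (λ _ ()) , (λ _ ()) , (λ ()) , (λ _ _ ()) , λ ()) , λ _ ()
    where
    H : Subgraph G
    H = record { inV = λ _ → ⊥ ; inE = λ _ _ → ⊥ ; inE-sym = λ () ; inE-edge = λ () ; inE-ends = λ () }

  K₁-oddMinor : ∀ v → OddMinorWithin (_≡ v) 1
  K₁-oddMinor v =
    (H , (λ _ → ⊥) , (λ _ ()) , branch , (λ { zero → v , refl , refl }) , connected ,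
     λ { zero zero 0≢0 → ⊥-elim (0≢0 refl) }) ,
    λ _ p → p
    where
    H : Subgraph G
    H = record { inV = _≡ v ; inE = λ _ _ → ⊥ ; inE-sym = λ () ; inE-edge = λ () ; inE-ends = λ () }
    branch : ∀ u → u ≡ v → Fin 1
    branch _ _ = zero
    connected : ∀ u w (p : u ≡ v) (q : w ≡ v) →
      (branch u p ≡ branch w q → Star (CutEdge H (λ _ → ⊥)) u w) ×
      (Star (CutEdge H (λ _ → ⊥)) u w → branch u p ≡ branch w q)
    connected u w refl refl = (λ _ → ε) , (λ _ → refl)

  independence-step : ∀ {t L} → (∀ S → ¬ OddMinorWithin (_∈ S) t → LargeIndependentSet S L) →
    ∀ S → Acc _<_ ∣ S ∣ → ¬ OddMinorWithin (_∈ S) (suc t) → LargeIndependentSet S (2 + L)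
  independence-step {t} {L} ih S (acc smaller) noMinor with nonempty? S
  ... | no empty = Empty⇒LargeIndependentSet empty
  ... | yes (v , v∈S) = MaximalTree-independent mt
    (ih attached noMinorInAttached)
    (independence-step ih remote (smaller ∣remote∣<∣S∣) (noMinor ∘ OddMinorWithin-mono remote⊆S))
    where
    mt = grow (singletonTree v∈S) (<-wellFounded _)
    open MaximalTree mt
    remote⊆S : remote ⊆ S
    remote⊆S = proj₁ ∘ ∈rest⁻ ∘ proj₁ ∘ ∈remote⁻
    ∣remote∣<∣S∣ : ∣ remote ∣ < ∣ S ∣
    ∣remote∣<∣S∣ = p⊂q⇒∣p∣<∣q∣
      (remote⊆S , root , I⊆S root∈I , λ root∈R → proj₂ (∈rest⁻ (proj₁ (∈remote⁻ root∈R))) (inj₁ root∈I))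
    inS : ∀ {u} → u ∈ attached ⊎ u ∈ I ⊎ u ∈ C → u ∈ S
    inS (inj₁ u∈A)        = proj₁ (∈rest⁻ (proj₁ (∈attached⁻ u∈A)))
    inS (inj₂ (inj₁ u∈I)) = I⊆S u∈I
    inS (inj₂ (inj₂ u∈C)) = C⊆S u∈C
    noMinorInAttached : ¬ OddMinorWithin (_∈ attached) t
    noMinorInAttached = attached-noOddMinor bipartite
      (proj₂ ∘ ∈rest⁻ ∘ proj₁ ∘ ∈attached⁻) (proj₂ ∘ ∈attached⁻) (noMinor ∘ OddMinorWithin-mono inS)

  independence : ∀ t S → ¬ OddMinorWithin (_∈ S) t → LargeIndependentSet S (pred (2 * t))
  independence zero          S noMinor = ⊥-elim (noMinor emptyOddMinor)
  independence (suc zero)    S noMinor =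
    Empty⇒LargeIndependentSet λ (v , v∈S) → noMinor (OddMinorWithin-mono (λ { refl → v∈S }) (K₁-oddMinor v))
  independence (suc (suc t)) S noMinor =
    subst (LargeIndependentSet S) (cong suc (sym (+-suc t (suc (t + 0)))))
      (independence-step (independence (suc t)) S (<-wellFounded ∣ S ∣) noMinor)

  -- Greedy colouring

  record Colouring (S : Subset n) (k : ℕ) : Set where
    field
      colour : ∀ {v} → v ∈ S → Fin k
      proper : ∀ {u v} (u∈S : u ∈ S) (v∈S : v ∈ S) → Edge G u v → colour u∈S ≢ colour v∈S

  Empty⇒Colouring : ∀ {S} → Empty S → Colouring S 0
  Empty⇒Colouring empty = record
    { colour = λ v∈S → ⊥-elim (empty (_ , v∈S))
    ; proper = λ u∈S _ _ → ⊥-elim (empty (_ , u∈S))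
    }

  Colouring-addClass : ∀ {S J k} → J ⊆ S → Independent J → Colouring (S ─ J) k → Colouring S (suc k)
  Colouring-addClass {S} {J} {k} J⊆S J-indep χ = record
    { colour = λ {v} v∈S → colourBy v∈S (v ∈? J)
    ; proper = λ {u} {v} u∈S v∈S → proper′ u∈S v∈S (u ∈? J) (v ∈? J)
    }
    where
    open Colouring χ
    colourBy : ∀ {v} → v ∈ S → Dec (v ∈ J) → Fin (suc k)
    colourBy _   (yes _)   = fromℕ k
    colourBy v∈S (no v∉J) = inject₁ (colour (x∈p∧x∉q⇒x∈p─q v∈S v∉J))
    proper′ : ∀ {u v} (u∈S : u ∈ S) (v∈S : v ∈ S) (u∈J? : Dec (u ∈ J)) (v∈J? : Dec (v ∈ J)) →
      Edge G u v → colourBy u∈S u∈J? ≢ colourBy v∈S v∈J?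
    proper′ _   _   (yes u∈J) (yes v∈J) e = ⊥-elim (J-indep u∈J v∈J e)
    proper′ _   _   (yes _)   (no _)    e = fromℕ≢inject₁
    proper′ _   _   (no _)    (yes _)   e = fromℕ≢inject₁ ∘ sym
    proper′ u∈S v∈S (no u∉J)  (no v∉J)  e = proper _ _ e ∘ inject₁-injective

  GreedyColouring : ℕ → Subset n → Set
  GreedyColouring t S = ∃ λ k → Colouring S k × k ≤ ∣ S ∣ × ColourBound t ∣ S ∣ k

  colourClass : ∀ {t S v} → (∀ S → LargeIndependentSet S (pred (2 * t))) → v ∈ S →
    ∃ λ J → J ⊆ S × Independent J × 1 ≤ ∣ J ∣ × (∣ S ∣ ≤ 2 * t ⊎ ∣ S ∣ ≤ pred (2 * t) * ∣ J ∣)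
  colourClass {t} {S} {v} large v∈S with ∣ S ∣ ≤? 2 * t
  ... | yes small = ⁅ v ⁆ , x∈p⇒⁅x⁆⊆p v∈S , ⁅x⁆-independent v , ≤-reflexive (sym (∣⁅x⁆∣≡1 v)) , inj₁ small
  ... | no big with large S
  ...   | largeIndependentSet J J⊆S J-indep ∣S∣≤pJ = J , J⊆S , J-indep , n≢0⇒n>0 ∣J∣≢0 , inj₂ ∣S∣≤pJ
    where
    ∣J∣≢0 : ∣ J ∣ ≢ 0
    ∣J∣≢0 ∣J∣≡0 = <⇒≱ (≰⇒> big) (begin
      ∣ S ∣                ≤⟨ ∣S∣≤pJ ⟩
      pred (2 * t) * ∣ J ∣ ≡⟨ cong (pred (2 * t) *_) ∣J∣≡0 ⟩
      pred (2 * t) * 0     ≡⟨ *-zeroʳ (pred (2 * t)) ⟩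
      0                    ≤⟨ z≤n ⟩
      2 * t                ∎)
      where open ≤-Reasoning

  greedyColouring′ : ∀ {t} → 1 ≤ t → (∀ S → LargeIndependentSet S (pred (2 * t))) →
    ∀ S → Acc _<_ ∣ S ∣ → GreedyColouring t S
  greedyColouring′ {t} 1≤t large S (acc smaller) with nonempty? S
  ... | no empty = 0 , Empty⇒Colouring empty , z≤n , few (≤-trans 1≤t (m≤m+n t _))
  ... | yes (v , v∈S) with colourClass {t} large v∈S
  ...   | J , J⊆S , J-indep , 1≤∣J∣ , smallOrLarge =
    let k , χ , k≤∣S─J∣ , bound = greedyColouring′ 1≤t large (S ─ J) (smaller ∣S─J∣<∣S∣)
        1+k≤∣S∣ = subst (suc k ≤_) (sym ∣S∣≡∣J∣+∣S─J∣) (+-mono-≤ 1≤∣J∣ k≤∣S─J∣)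
    in suc k , Colouring-addClass J⊆S J-indep χ , 1+k≤∣S∣ ,
       ColourBound-step 1≤t ∣S∣≡∣J∣+∣S─J∣ 1+k≤∣S∣ smallOrLarge bound
    where
    ∣S∣≡∣J∣+∣S─J∣ : ∣ S ∣ ≡ ∣ J ∣ + ∣ S ─ J ∣
    ∣S∣≡∣J∣+∣S─J∣ = q⊆p⇒∣p∣≡∣q∣+∣p─q∣ J⊆S
    ∣S─J∣<∣S∣ : ∣ S ─ J ∣ < ∣ S ∣
    ∣S─J∣<∣S∣ = subst (∣ S ─ J ∣ <_) (sym ∣S∣≡∣J∣+∣S─J∣) (m<n+m _ 1≤∣J∣)

  greedyColouring : ∀ {t} → 1 ≤ t → (∀ S → LargeIndependentSet S (pred (2 * t))) → ∀ S → GreedyColouring t S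
  greedyColouring 1≤t large S = greedyColouring′ 1≤t large S (<-wellFounded ∣ S ∣)


corollary2p5 : (t n : ℕ) → 1 ≤ t → t ≤ n → (G : Graph n) → ¬ HasOddMinor G t →
    ∃ λ k → Σ (Fin n → Fin k) λ c → ProperColouring G k c × LogBound t n k
corollary2p5 t n 1≤t t≤n G noMinor
  with greedyColouring G 1≤t (λ S → independence G t S (noMinor ∘ proj₁)) ⊤
... | k , χ , _ , bound =
  k , (λ v → colour (∈⊤ {x = v})) , (λ _ _ → proper ∈⊤ ∈⊤) ,
  logBound 1≤t t≤n (subst (λ m → ColourBound t m k) (∣⊤∣≡n n) bound)
  where open Colouring χ
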